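{- For every formula $\varphi$ of $\mathrm{TeamCTL}(\mathsf X,\mathsf G_\forall,\mathsf M_\exists)$ there exists a formula $\psi$ of asynchronous $\mathrm{TeamLTL}$ using $\mathsf M$ instead of $\mathsf U$ such that $T\models\varphi\iff T\models\psi$ for every finite multiteam $T$; and conversely, for every formula $\psi$ of asynchronous $\mathrm{TeamLTL}$ using $\mathsf M$ instead of $\mathsf U$ there is such a formula $\varphi$ of $\mathrm{TeamCTL}(\mathsf X,\mathsf G_\forall,\mathsf M_\exists)$.
   Context: Traces over $\mathrm{AP}$ are $t\in(2^{\mathrm{AP}})^\omega$; $t[i,\infty]$ is the suffix from $i$. A multiteam is a set $T$ of pairs $(i,t)$ (index, trace) with distinct indices; for $g:T\to\mathbb N$, $T[g,\infty]=\{(i,t[g((i,t)),\infty])\mid(i,t)\in T\}$; $\uplus$ denotes disjoint union. A time evaluation function (tef) for $T$ is $\tau:\mathbb N\times T\to\mathbb N$ with $\tau(i+1,t)\in\{\tau(i,t),\tau(i,t)+1\}$ for all $i,t$, and $\tau(i,\cdot)\neq\tau(i+1,\cdot)$ for all $i$; it is initial if $\tau(0,t)=0$ for all $t$; $\tau(k)$ denotes $t\mapsto\tau(k,t)$. Common clauses for both logics: $T\models l$ (literal $p$ or $\neg p$) iff $t\models l$ for all $(i,t)\in T$; $\land$ as usual; $T\models\varphi\lor\psi$ iff $T=T_1\uplus T_2$ with $T_1\models\varphi$, $T_2\models\psi$; $T\models\mathsf X\varphi$ iff $T[1,\infty]\models\varphi$ ($1$ the constant function). $\mathrm{TeamCTL}(\mathsf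 X,\mathsf G_\forall,\mathsf M_\exists)$: formulae built from literals with $\land,\lor,\mathsf X,\mathsf G_\forall,\mathsf M_\exists$; $T\models\mathsf G_\forall\varphi$ iff for all initial tefs $\tau$ and all $k$, $T[\tau(k),\infty]\models\varphi$; $[\psi\,\mathsf M_\exists\,\varphi]:=[\varphi\,\mathsf U_\exists(\varphi\land\psi)]$, where $T\models[\varphi\,\mathsf U_\exists\chi]$ iff there are an initial tef $\tau$ and $k$ with $T[\tau(k),\infty]\models\chi$ and $T[\tau(m),\infty]\models\varphi$ for all $m<k$. Asynchronous $\mathrm{TeamLTL}$ using $\mathsf M$ instead of $\mathsf U$: formulae built from literals with $\land,\lor,\mathsf X,\mathsf G$ and $[\psi\,\mathsf M\,\varphi]:=[\varphi\,\mathsf U(\varphi\land\psi)]$; $T\models\mathsf G\varphi$ iff $T[f,\infty]\models\varphi$ for all $f:T\to\mathbb N$; $T\models\varphi\,\mathsf U\,\chi$ iff there is $f:T\to\mathbb N$ with $T[f,\infty]\models\chi$ and all $f':T'\to\mathbb N$ with $f'(t)<f(t)$ for $t\in T'=\{t\in T\mid f(t)\ne0\}$ satisfy $T'[f',\infty]\models\varphi$. -}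

module Defs where

open import Data.Nat using (ℕ; zero; suc; _+_; _<_)
open import Data.Bool using (Bool; true; false)
open import Data.Product using (Σ; ∃; _×_; _,_; proj₁)
open import Data.Fin using (Fin)
open import Data.Sum using (_⊎_)
open import Relation.Nullary using (¬_)
open import Relation.Binary.PropositionalEquality using (_≡_)
open import Function.Bundles using (_⇔_)

-- Traces over AP: t ∈ (2^AP)^ω, a letter being the characteristic function of a subset of AP.
Trace : Set → Set
Trace AP = ℕ → AP → Bool

suffix : {AP : Set} → Trace AP → ℕ → Trace AP
suffix t i k = t (i + k)

-- A multiteam is given by an index set I together with the trace of each index.
-- (Indices are pairwise distinct by construction.)  T[g,∞]:
shiftTeam : {AP I : Set} → (I → Trace AP) → (I → ℕ) → (I → Trace AP)
shiftTeam T g i = suffix (T i) (g i)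

-- Disjoint splitting T = T₁ ⊎ T₂ via a colouring s : I → Bool.
Part : {I : Set} → (I → Bool) → Bool → Set
Part {I} s b = Σ I (λ i → s i ≡ b)

restrict : {AP I : Set} → (I → Trace AP) → {P : I → Set} → Σ I P → Trace AP
restrict T x = T (proj₁ x)

data Literal (AP : Set) : Set where
  pos : AP → Literal AP
  neg : AP → Literal AP

litSat : {AP : Set} → Literal AP → Trace AP → Set
litSat (pos p) t = t 0 p ≡ true
litSat (neg p) t = t 0 p ≡ false

data CTLForm (AP : Set) : Set where
  lit  : Literal AP → CTLForm AP
  _∧_  : CTLForm AP → CTLForm AP → CTLForm AP
  _∨_  : CTLForm AP → CTLForm AP → CTLForm AP
  X    : CTLForm AP → CTLForm AP
  G∀   : CTLForm AP → CTLForm AP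
  M∃   : CTLForm AP → CTLForm AP → CTLForm AP

-- Time evaluation functions τ : ℕ × T → ℕ.
-- Non-stuttering "τ(k,·) ≠ τ(k+1,·)" is stated as: if τ(k+1,·) agrees with
-- τ(k,·) everywhere then the team is empty.
record IsInitialTef (I : Set) (τ : ℕ → I → ℕ) : Set where
  field
    initial      : ∀ i → τ 0 i ≡ 0
    stepwise     : ∀ k i → (τ (suc k) i ≡ τ k i) ⊎ (τ (suc k) i ≡ suc (τ k i))
    nonstuttering : ∀ k → (∀ i → τ (suc k) i ≡ τ k i) → ¬ I

ctlSat : {AP : Set} → CTLForm AP → (I : Set) → (I → Trace AP) → Set
ctlSat (lit l) I T = ∀ i → litSat l (T i)
ctlSat (φ ∧ ψ) I T = ctlSat φ I T × ctlSat ψ I T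
ctlSat (φ ∨ ψ) I T = ∃ λ (s : I → Bool) →
  ctlSat φ (Part s true) (restrict T) × ctlSat ψ (Part s false) (restrict T)
ctlSat (X φ) I T = ctlSat φ I (shiftTeam T (λ _ → 1))
ctlSat (G∀ φ) I T = ∀ (τ : ℕ → I → ℕ) → IsInitialTef I τ → ∀ k → ctlSat φ I (shiftTeam T (τ k))
-- [ψ M_∃ φ] := [φ U_∃ (φ ∧ ψ)]
ctlSat (M∃ ψ φ) I T = ∃ λ (τ : ℕ → I → ℕ) → IsInitialTef I τ × ∃ λ k →
  (ctlSat φ I (shiftTeam T (τ k)) × ctlSat ψ I (shiftTeam T (τ k))) ×
  (∀ m → m < k → ctlSat φ I (shiftTeam T (τ m)))

data LTLForm (AP : Set) : Set where
  lit  : Literal AP → LTLForm AP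
  _∧_  : LTLForm AP → LTLForm AP → LTLForm AP
  _∨_  : LTLForm AP → LTLForm AP → LTLForm AP
  X    : LTLForm AP → LTLForm AP
  G    : LTLForm AP → LTLForm AP
  M    : LTLForm AP → LTLForm AP → LTLForm AP

Moved : (I : Set) → (I → ℕ) → Set
Moved I f = Σ I (λ i → 0 < f i)

ltlSat : {AP : Set} → LTLForm AP → (I : Set) → (I → Trace AP) → Set
ltlSat (lit l) I T = ∀ i → litSat l (T i)
ltlSat (φ ∧ ψ) I T = ltlSat φ I T × ltlSat ψ I T
ltlSat (φ ∨ ψ) I T = ∃ λ (s : I → Bool) →
  ltlSat φ (Part s true) (restrict T) × ltlSat ψ (Part s false) (restrict T)
ltlSat (X φ) I T = ltlSat φ I (shiftTeam T (λ _ → 1))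
ltlSat (G φ) I T = ∀ (f : I → ℕ) → ltlSat φ I (shiftTeam T f)
-- [ψ M φ] := [φ U (φ ∧ ψ)]
ltlSat (M ψ φ) I T = ∃ λ (f : I → ℕ) →
  (ltlSat φ I (shiftTeam T f) × ltlSat ψ I (shiftTeam T f)) ×
  (∀ (f' : Moved I f → ℕ) → (∀ j → f' j < f (proj₁ j)) →
     ltlSat φ (Moved I f) (shiftTeam (restrict T) f'))

-- Finite multiteams: indexed by Fin n.

_≡ᶠ_ : {AP : Set} → CTLForm AP → LTLForm AP → Set
φ ≡ᶠ ψ = ∀ (n : ℕ) (T : Fin n → Trace _) → (ctlSat φ (Fin n) T ⇔ ltlSat ψ (Fin n) T)

{-# OPTIONS --safe #-}
-- Both logics are flat on finite multiteams: a team satisfies a formula iff each of its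
-- traces does, under the evident single-trace semantics in which G∀ and G quantify over all
-- positions and M∃ and M ask for one position.  The two logics have the same single-trace
-- semantics, so the syntactic correspondence G∀ ↔ G, M∃ ↔ M is the required translation.
-- Flatness of the synchronous operators needs finiteness: to synchronise the witnesses
-- n i of the individual traces for M∃, each trace runs up to n i and then waits until the
-- slowest one, at time max n, has arrived.
module Submission where

open import Defs
open import Data.Product using (_×_; ∃; _,_; proj₁; proj₂)
open import Data.Nat using (ℕ; zero; suc; _+_; _<_; _≤_; _∸_; _⊓_; _⊔_; pred; z≤n; s≤s; _<?_)
open import Data.Nat.Properties
open import Data.Bool using (Bool; true; false)
import Data.Bool.Properties as Bool
open import Data.Fin using (Fin)
import Data.Fin as Fin
open import Data.Sum using (_⊎_; inj₁; inj₂)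
open import Data.Empty using (⊥-elim)
open import Relation.Nullary using (¬_; yes; no)
open import Relation.Binary.PropositionalEquality
open import Axiom.UniquenessOfIdentityProofs using (module Decidable⇒UIP)
open import Function.Bundles using (_⇔_; mk⇔)
open import Function.Properties.Equivalence using () renaming (trans to ⇔-trans; sym to ⇔-sym)

module _ {I : Set} {P Q : I → Set} where

  uncolour : (s : I → Bool) → (∀ (j : Part s true) → P (proj₁ j)) →
    (∀ (j : Part s false) → Q (proj₁ j)) → ∀ i → P i ⊎ Q i
  uncolour s p q i with s i in e
  ... | true  = inj₁ (p (i , e))
  ... | false = inj₂ (q (i , e))

  colour : (∀ i → P i ⊎ Q i) → ∃ λ (s : I → Bool) →
    (∀ (j : Part s true) → P (proj₁ j)) × (∀ (j : Part s false) → Q (proj₁ j))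
  colour h = (λ i → isLeft (h i)) , (λ (i , e) → fromLeft (h i) e) , (λ (i , e) → fromRight (h i) e)
    where
    isLeft : ∀ {i} → P i ⊎ Q i → Bool
    isLeft (inj₁ _) = true
    isLeft (inj₂ _) = false

    fromLeft : ∀ {i} (x : P i ⊎ Q i) → isLeft x ≡ true → P i
    fromLeft (inj₁ p) _ = p

    fromRight : ∀ {i} (x : P i ⊎ Q i) → isLeft x ≡ false → Q i
    fromRight (inj₂ q) _ = q

IsTightBound : {I : Set} → (I → ℕ) → ℕ → Set
IsTightBound {I} n K = (∀ i → n i ≤ K) × (∀ m → m < K → ∃ λ i → m < n i)

HasTightBounds : Set → Set
HasTightBounds I = ∀ (n : I → ℕ) → ∃ (IsTightBound n)

Fin-hasTightBounds : ∀ k → HasTightBounds (Fin k)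
Fin-hasTightBounds zero    n = 0 , (λ ()) , (λ _ ())
Fin-hasTightBounds (suc k) n with Fin-hasTightBounds k (λ j → n (Fin.suc j))
... | K , n≤K , tight = n Fin.zero ⊔ K , below , tight′
  where
  below : ∀ i → n i ≤ n Fin.zero ⊔ K
  below Fin.zero    = m≤m⊔n (n Fin.zero) K
  below (Fin.suc j) = ≤-trans (n≤K j) (m≤n⊔m (n Fin.zero) K)

  tight′ : ∀ m → m < n Fin.zero ⊔ K → ∃ λ i → m < n i
  tight′ m m< with ⊔-sel (n Fin.zero) K
  ... | inj₁ e = Fin.zero , subst (m <_) e m<
  ... | inj₂ e = let j , m<nj = tight m (subst (m <_) e m<) in Fin.suc j , m<nj

module _ {I : Set} (s : I → Bool) (b : Bool) (n : Part s b → ℕ) where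

  -- outside the part the family is extended by 0, which affects neither bound
  extendByZero : I → ℕ
  extendByZero i with s i Bool.≟ b
  ... | yes e = n (i , e)
  ... | no _  = 0

  extendByZero-≡ : ∀ i (e : s i ≡ b) → extendByZero i ≡ n (i , e)
  extendByZero-≡ i e with s i Bool.≟ b
  ... | yes e′ = cong (λ e → n (i , e)) (Decidable⇒UIP.≡-irrelevant Bool._≟_ e′ e)
  ... | no s≢b = ⊥-elim (s≢b e)

  extendByZero-< : ∀ {m} i → m < extendByZero i → ∃ λ j → m < n j
  extendByZero-< i m<ext with s i Bool.≟ b
  ... | yes e = (i , e) , m<ext
  ... | no _  = ⊥-elim (<⇒≱ m<ext z≤n)

Part-hasTightBounds : {I : Set} → HasTightBounds I → (s : I → Bool) (b : Bool) →
  HasTightBounds (Part s b)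
Part-hasTightBounds bounds s b n with bounds (extendByZero s b n)
... | K , n≤K , tight =
  K , (λ (i , e) → subst (_≤ K) (extendByZero-≡ s b n i e) (n≤K i)) ,
  (λ m m<K → let i , m<ext = tight m m<K in extendByZero-< s b n i m<ext)

stepwise-hits : (g : ℕ → ℕ) → g 0 ≡ 0 → (∀ k → (g (suc k) ≡ g k) ⊎ (g (suc k) ≡ suc (g k))) →
  ∀ k m → m < g k → ∃ λ m′ → m′ < k × g m′ ≡ m
stepwise-hits g g0≡0 step zero m m<g0 = ⊥-elim (<⇒≱ (subst (m <_) g0≡0 m<g0) z≤n)
stepwise-hits g g0≡0 step (suc k) m m<gk+1 with m <? g k | step k
... | yes m<gk | _ = let m′ , m′<k , e = stepwise-hits g g0≡0 step k m m<gk
                     in m′ , m≤n⇒m≤1+n m′<k , e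
... | no m≮gk | inj₁ e = ⊥-elim (m≮gk (subst (m <_) e m<gk+1))
... | no m≮gk | inj₂ e = k , ≤-refl , ≤-antisym (≮⇒≥ m≮gk) (≤-pred (subst (m <_) e m<gk+1))

-- A local clock that runs with global time up to x, pauses, and resumes at global time K.
pausedClock : ℕ → ℕ → ℕ → ℕ
pausedClock K x m = m ⊓ x + (m ∸ K)

module _ {K x : ℕ} (x≤K : x ≤ K) where

  pausedClock-runs-early : ∀ {m} → m < x → pausedClock K x (suc m) ≡ suc (pausedClock K x m)
  pausedClock-runs-early {m} m<x
    rewrite m≤n⇒m⊓n≡m m<x | m≤n⇒m⊓n≡m (<⇒≤ m<x)
          | m≤n⇒m∸n≡0 (≤-trans m<x x≤K) | m≤n⇒m∸n≡0 (<⇒≤ (≤-trans m<x x≤K)) = refl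

  pausedClock-runs-late : ∀ {m} → K ≤ m → pausedClock K x (suc m) ≡ suc (pausedClock K x m)
  pausedClock-runs-late {m} K≤m
    rewrite m≥n⇒m⊓n≡n (m≤n⇒m≤1+n (≤-trans x≤K K≤m)) | m≥n⇒m⊓n≡n (≤-trans x≤K K≤m)
          | +-∸-assoc 1 K≤m = +-suc x (m ∸ K)

  pausedClock-pauses : ∀ {m} → x ≤ m → m < K → pausedClock K x (suc m) ≡ pausedClock K x m
  pausedClock-pauses {m} x≤m m<K
    rewrite m≥n⇒m⊓n≡n (m≤n⇒m≤1+n x≤m) | m≥n⇒m⊓n≡n x≤m
          | m≤n⇒m∸n≡0 m<K | m≤n⇒m∸n≡0 (<⇒≤ m<K) = refl

  pausedClock-stepwise : ∀ m →
    (pausedClock K x (suc m) ≡ pausedClock K x m) ⊎ (pausedClock K x (suc m) ≡ suc (pausedClock K x m))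
  pausedClock-stepwise m with m <? x | m <? K
  ... | yes m<x | _       = inj₂ (pausedClock-runs-early m<x)
  ... | no m≮x  | yes m<K = inj₁ (pausedClock-pauses (≮⇒≥ m≮x) m<K)
  ... | no _    | no m≮K  = inj₂ (pausedClock-runs-late (≮⇒≥ m≮K))

  pausedClock-at : pausedClock K x K ≡ x
  pausedClock-at rewrite m≥n⇒m⊓n≡n x≤K | n∸n≡0 K = +-identityʳ x

pausedClock-before : ∀ K x {m} → m < K → pausedClock K x m ≡ m ⊓ x
pausedClock-before K x m<K rewrite m≤n⇒m∸n≡0 (<⇒≤ m<K) = +-identityʳ _

globalClock-isInitialTef : (I : Set) → IsInitialTef I (λ k _ → k)
globalClock-isInitialTef I = record
  { initial       = λ _ → refl
  ; stepwise      = λ _ _ → inj₂ refl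
  ; nonstuttering = λ k k+1≡k i → 1+n≢n (k+1≡k i)
  }

pausedClocks-isInitialTef : (I : Set) (n : I → ℕ) (K : ℕ) → IsTightBound n K →
  IsInitialTef I (λ m i → pausedClock K (n i) m)
pausedClocks-isInitialTef I n K (n≤K , tight) = record
  { initial       = λ _ → 0∸n≡0 K
  ; stepwise      = λ m i → pausedClock-stepwise (n≤K i) m
  ; nonstuttering = nonstuttering
  }
  where
  -- before K the clock of a trace with m < n i runs; from K on all clocks run
  nonstuttering : ∀ m → (∀ i → pausedClock K (n i) (suc m) ≡ pausedClock K (n i) m) → ¬ I
  nonstuttering m paused i₀ with m <? K
  ... | yes m<K = let i , m<ni = tight m m<K
                  in 1+n≢n (trans (sym (pausedClock-runs-early (n≤K i) m<ni)) (paused i))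
  ... | no m≮K  = 1+n≢n (trans (sym (pausedClock-runs-late (n≤K i₀) (≮⇒≥ m≮K))) (paused i₀))

m⊓pred<self : ∀ m {x} → 0 < x → m ⊓ pred x < x
m⊓pred<self m {suc x} _ = s≤s (m⊓n≤n m x)

⊓-closure : (P : ℕ → Set) {n : ℕ} → P n → (∀ m → m < n → P m) → ∀ m → P (m ⊓ n)
⊓-closure P {n} Pn P<n m with m <? n
... | yes m<n = subst P (sym (m≤n⇒m⊓n≡m (<⇒≤ m<n))) (P<n m m<n)
... | no m≮n  = subst P (sym (m≥n⇒m⊓n≡n (≮⇒≥ m≮n))) Pn

module _ {AP : Set} where

  infix 4 _⊨_

  _⊨_ : Trace AP → CTLForm AP → Set
  t ⊨ lit l    = litSat l t
  t ⊨ φ ∧ ψ    = t ⊨ φ × t ⊨ ψ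
  t ⊨ φ ∨ ψ    = t ⊨ φ ⊎ t ⊨ ψ
  t ⊨ X φ      = suffix t 1 ⊨ φ
  t ⊨ G∀ φ     = ∀ n → suffix t n ⊨ φ
  t ⊨ M∃ ψ φ   = ∃ λ n → (suffix t n ⊨ φ × suffix t n ⊨ ψ) × (∀ m → m < n → suffix t m ⊨ φ)

  toLTL : CTLForm AP → LTLForm AP
  toLTL (lit l)  = lit l
  toLTL (φ ∧ ψ)  = toLTL φ ∧ toLTL ψ
  toLTL (φ ∨ ψ)  = toLTL φ ∨ toLTL ψ
  toLTL (X φ)    = X (toLTL φ)
  toLTL (G∀ φ)   = G (toLTL φ)
  toLTL (M∃ ψ φ) = M (toLTL ψ) (toLTL φ)

  toCTL : LTLForm AP → CTLForm AP
  toCTL (lit l) = lit l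
  toCTL (φ ∧ ψ) = toCTL φ ∧ toCTL ψ
  toCTL (φ ∨ ψ) = toCTL φ ∨ toCTL ψ
  toCTL (X φ)   = X (toCTL φ)
  toCTL (G φ)   = G∀ (toCTL φ)
  toCTL (M ψ φ) = M∃ (toCTL ψ) (toCTL φ)

  toLTL∘toCTL : ∀ ψ → toLTL (toCTL ψ) ≡ ψ
  toLTL∘toCTL (lit l) = refl
  toLTL∘toCTL (φ ∧ ψ) = cong₂ _∧_ (toLTL∘toCTL φ) (toLTL∘toCTL ψ)
  toLTL∘toCTL (φ ∨ ψ) = cong₂ _∨_ (toLTL∘toCTL φ) (toLTL∘toCTL ψ)
  toLTL∘toCTL (X φ)   = cong X (toLTL∘toCTL φ)
  toLTL∘toCTL (G φ)   = cong G (toLTL∘toCTL φ)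
  toLTL∘toCTL (M ψ φ) = cong₂ M (toLTL∘toCTL ψ) (toLTL∘toCTL φ)

  All⊨ : (I : Set) → (I → Trace AP) → CTLForm AP → Set
  All⊨ I T φ = ∀ i → T i ⊨ φ

  ltlSat⇒All⊨ : ∀ φ (I : Set) (T : I → Trace AP) → ltlSat (toLTL φ) I T → All⊨ I T φ
  ltlSat⇒All⊨ (lit l)  I T h i = h i
  ltlSat⇒All⊨ (φ ∧ ψ)  I T (hφ , hψ) i = ltlSat⇒All⊨ φ I T hφ i , ltlSat⇒All⊨ ψ I T hψ i
  ltlSat⇒All⊨ (φ ∨ ψ)  I T (s , hφ , hψ) =
    uncolour s (ltlSat⇒All⊨ φ _ (restrict T) hφ) (ltlSat⇒All⊨ ψ _ (restrict T) hψ)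
  ltlSat⇒All⊨ (X φ)    I T h = ltlSat⇒All⊨ φ I _ h
  ltlSat⇒All⊨ (G∀ φ)   I T h i n = ltlSat⇒All⊨ φ I _ (h (λ _ → n)) i
  ltlSat⇒All⊨ (M∃ ψ φ) I T (f , (hφ , hψ) , before) i =
    f i , (ltlSat⇒All⊨ φ I _ hφ i , ltlSat⇒All⊨ ψ I _ hψ i) , φ-before
    where
    -- the moved traces are all sent to m, clamped below their own targets
    φ-before : ∀ m → m < f i → suffix (T i) m ⊨ φ
    φ-before m m<fi = subst (λ k → suffix (T i) k ⊨ φ) (m≤n⇒m⊓n≡m (pred-mono-≤ m<fi))
      (ltlSat⇒All⊨ φ (Moved I f) _
        (before (λ j → m ⊓ pred (f (proj₁ j))) (λ (_ , 0<f) → m⊓pred<self m 0<f))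
        (i , ≤-trans (s≤s z≤n) m<fi))

  All⊨⇒ltlSat : ∀ φ (I : Set) (T : I → Trace AP) → All⊨ I T φ → ltlSat (toLTL φ) I T
  All⊨⇒ltlSat (lit l)  I T h = h
  All⊨⇒ltlSat (φ ∧ ψ)  I T h =
    All⊨⇒ltlSat φ I T (λ i → proj₁ (h i)) , All⊨⇒ltlSat ψ I T (λ i → proj₂ (h i))
  All⊨⇒ltlSat (φ ∨ ψ)  I T h with colour h
  ... | s , hφ , hψ = s , All⊨⇒ltlSat φ _ _ hφ , All⊨⇒ltlSat ψ _ _ hψ
  All⊨⇒ltlSat (X φ)    I T h = All⊨⇒ltlSat φ I _ h
  All⊨⇒ltlSat (G∀ φ)   I T h f = All⊨⇒ltlSat φ I _ (λ i → h i (f i))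
  All⊨⇒ltlSat (M∃ ψ φ) I T h =
    (λ i → proj₁ (h i)) ,
    (All⊨⇒ltlSat φ I _ (λ i → proj₁ (proj₁ (proj₂ (h i)))) ,
     All⊨⇒ltlSat ψ I _ (λ i → proj₂ (proj₁ (proj₂ (h i))))) ,
    λ f′ f′< → All⊨⇒ltlSat φ _ _ (λ j@(i , _) → proj₂ (proj₂ (h i)) (f′ j) (f′< j))

  ctlSat⇒All⊨ : ∀ φ (I : Set) (T : I → Trace AP) → ctlSat φ I T → All⊨ I T φ
  ctlSat⇒All⊨ (lit l)  I T h i = h i
  ctlSat⇒All⊨ (φ ∧ ψ)  I T (hφ , hψ) i = ctlSat⇒All⊨ φ I T hφ i , ctlSat⇒All⊨ ψ I T hψ i
  ctlSat⇒All⊨ (φ ∨ ψ)  I T (s , hφ , hψ) =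
    uncolour s (ctlSat⇒All⊨ φ _ (restrict T) hφ) (ctlSat⇒All⊨ ψ _ (restrict T) hψ)
  ctlSat⇒All⊨ (X φ)    I T h = ctlSat⇒All⊨ φ I _ h
  ctlSat⇒All⊨ (G∀ φ)   I T h i n = ctlSat⇒All⊨ φ I _ (h _ (globalClock-isInitialTef I) n) i
  ctlSat⇒All⊨ (M∃ ψ φ) I T (τ , tef , k , (hφ , hψ) , before) i =
    τ k i , (ctlSat⇒All⊨ φ I _ hφ i , ctlSat⇒All⊨ ψ I _ hψ i) , φ-before
    where
    open IsInitialTef tef
    φ-before : ∀ m → m < τ k i → suffix (T i) m ⊨ φ
    φ-before m m<τki with stepwise-hits (λ j → τ j i) (initial i) (λ j → stepwise j i) k m m<τki
    ... | m′ , m′<k , refl = ctlSat⇒All⊨ φ I _ (before m′ m′<k) i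

  All⊨⇒ctlSat : ∀ φ (I : Set) → HasTightBounds I → (T : I → Trace AP) → All⊨ I T φ → ctlSat φ I T
  All⊨⇒ctlSat (lit l)  I bounds T h = h
  All⊨⇒ctlSat (φ ∧ ψ)  I bounds T h =
    All⊨⇒ctlSat φ I bounds T (λ i → proj₁ (h i)) , All⊨⇒ctlSat ψ I bounds T (λ i → proj₂ (h i))
  All⊨⇒ctlSat (φ ∨ ψ)  I bounds T h with colour h
  ... | s , hφ , hψ = s , All⊨⇒ctlSat φ _ (Part-hasTightBounds bounds s true) _ hφ
                        , All⊨⇒ctlSat ψ _ (Part-hasTightBounds bounds s false) _ hψ
  All⊨⇒ctlSat (X φ)    I bounds T h = All⊨⇒ctlSat φ I bounds _ h
  All⊨⇒ctlSat (G∀ φ)   I bounds T h τ _ k = All⊨⇒ctlSat φ I bounds _ (λ i → h i (τ k i))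
  All⊨⇒ctlSat (M∃ ψ φ) I bounds T h with bounds (λ i → proj₁ (h i))
  ... | K , bound@(n≤K , _) =
    (λ m i → pausedClock K (n i) m) , pausedClocks-isInitialTef I n K bound , K ,
    (All⊨⇒ctlSat φ I bounds _ (λ i → at-K φ i (proj₁ (proj₁ (proj₂ (h i))))) ,
     All⊨⇒ctlSat ψ I bounds _ (λ i → at-K ψ i (proj₂ (proj₁ (proj₂ (h i)))))) ,
    λ m m<K → All⊨⇒ctlSat φ I bounds _ λ i →
      subst (λ k → suffix (T i) k ⊨ φ) (sym (pausedClock-before K (n i) m<K))
        (⊓-closure (λ k → suffix (T i) k ⊨ φ)
          (proj₁ (proj₁ (proj₂ (h i)))) (proj₂ (proj₂ (h i))) m)
    where
    n : I → ℕ
    n i = proj₁ (h i)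

    at-K : ∀ χ i → suffix (T i) (n i) ⊨ χ → suffix (T i) (pausedClock K (n i) K) ⊨ χ
    at-K χ i = subst (λ k → suffix (T i) k ⊨ χ) (sym (pausedClock-at (n≤K i)))

  ctlSat⇔All⊨ : ∀ φ (I : Set) → HasTightBounds I → (T : I → Trace AP) → ctlSat φ I T ⇔ All⊨ I T φ
  ctlSat⇔All⊨ φ I bounds T = mk⇔ (ctlSat⇒All⊨ φ I T) (All⊨⇒ctlSat φ I bounds T)

  ltlSat⇔All⊨ : ∀ φ (I : Set) (T : I → Trace AP) → ltlSat (toLTL φ) I T ⇔ All⊨ I T φ
  ltlSat⇔All⊨ φ I T = mk⇔ (ltlSat⇒All⊨ φ I T) (All⊨⇒ltlSat φ I T)

  ≡ᶠ-toLTL : ∀ φ → φ ≡ᶠ toLTL φ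
  ≡ᶠ-toLTL φ n T = ⇔-trans (ctlSat⇔All⊨ φ (Fin n) (Fin-hasTightBounds n) T) (⇔-sym (ltlSat⇔All⊨ φ (Fin n) T))

corollary19 : (AP : Set) →
    (∀ (φ : CTLForm AP) → ∃ λ (ψ : LTLForm AP) → φ ≡ᶠ ψ) ×
    (∀ (ψ : LTLForm AP) → ∃ λ (φ : CTLForm AP) → φ ≡ᶠ ψ)
corollary19 AP =
  (λ φ → toLTL φ , ≡ᶠ-toLTL φ) ,
  (λ ψ → toCTL ψ , subst (toCTL ψ ≡ᶠ_) (toLTL∘toCTL ψ) (≡ᶠ-toLTL (toCTL ψ)))
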